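{- Let $n$ be a positive integer with $100 \mid n$. Then: (1) if $\mathrm{lnzd}(n) \in \{2,4,6,8\}$, then $\mathrm{rbln}(n^n) = 7$; (2) if $\mathrm{lnzd}(n) = 5$, then $\mathrm{rbln}(n^n) = 2$; (3) if $\mathrm{lnzd}(n) \in \{1,3,7,9\}$, then $\mathrm{rbln}(n^n) = 0$.
   Context: For a positive integer $m$ written in base $10$, $\mathrm{lnzd}(m)$ denotes the last (rightmost) non-zero decimal digit of $m$. Also $\mathrm{rbln}(m)$ is defined as follows: if $m$ has exactly one non-zero decimal digit, then $\mathrm{rbln}(m)=0$; if $m$ has at least two non-zero decimal digits, then $\mathrm{rbln}(m)$ is the decimal digit immediately to the left of the last non-zero digit of $m$ (this digit may itself be $0$). For example, $\mathrm{rbln}(1000)=0$ and $\mathrm{rbln}(10504200)=4$. -}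

module Defs where

open import Data.Nat using (ℕ; zero; suc; _+_; _≡ᵇ_)
open import Data.Nat.DivMod using (_/_; _%_)
open import Data.List using (List; []; _∷_; length; filter)
open import Data.Bool using (if_then_else_)
open import Relation.Nullary using (¬?)
open import Data.Nat using (_≟_)

-- Decimal digits of m, least significant first (no leading zeros; [] for 0).
-- The fuel argument (initialised with m itself) only ensures termination;
-- m digits of fuel always suffice since m / 10 < m for m > 0.
digitsAux : ℕ → ℕ → List ℕ
digitsAux zero    m       = []
digitsAux (suc f) zero    = []
digitsAux (suc f) (suc m) = (suc m % 10) ∷ digitsAux f (suc m / 10)

digits : ℕ → List ℕ
digits m = digitsAux m m

-- drop trailing zero digits (i.e. leading zeros of the LSB-first list)
dropZeros : List ℕ → List ℕ
dropZeros []       = []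
dropZeros (d ∷ ds) = if d ≡ᵇ 0 then dropZeros ds else d ∷ ds

nonzeroDigitCount : ℕ → ℕ
nonzeroDigitCount m = length (filter (λ d → ¬? (d ≟ 0)) (digits m))

-- last (rightmost) non-zero decimal digit of m (0 for m = 0, irrelevant)
lnzd : ℕ → ℕ
lnzd m with dropZeros (digits m)
... | []    = 0
... | d ∷ _ = d

-- digit immediately to the left of the last non-zero digit, or 0 if m has
-- exactly one non-zero digit
rbln : ℕ → ℕ
rbln m = if nonzeroDigitCount m ≡ᵇ 1 then 0 else leftOf (dropZeros (digits m))
  where
  leftOf : List ℕ → ℕ
  leftOf (_ ∷ e ∷ _) = e
  leftOf _           = 0

-- Write n = m · 10^k with m % 10 ≢ 0. Trailing zeros change neither lnzd nor rbln, so
-- lnzd n = m % 10 and rbln (n^n) = rbln (m^n), which is the tens digit of m^n once its unit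
-- digit is non-zero. As 20 ∣ n, m^n = (m^20)^(n/20), and m^20 mod 100 is an idempotent of
-- ℤ/100 ≅ ℤ/4 × ℤ/25 (λ(100) = 20 sends units to 1, a factor 2 vanishes in ℤ/4 and a factor 5
-- in ℤ/25): it is 1 for m coprime to 10, 76 ≡ (0, 1) for m even and 25 ≡ (1, 0) for 5 ∣ m.
-- So m^n ≡ m^20 (mod 100), whose tens digit is 0, 7 or 2.
module Submission where

open import Defs
open import Data.Nat
open import Data.Nat.Properties
open import Data.Nat.DivMod
open import Data.Nat.Divisibility using (_∣_; divides; ∣-trans; ∣⇒≤; m%n≡0⇒n∣m)
open import Data.Nat.Induction using (<-rec)
open import Data.List using ([]; _∷_)
open import Data.Bool using (true; false; if_then_else_)
open import Data.Bool.Properties using (if-eta)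
open import Data.Fin using (Fin; toℕ; fromℕ<)
open import Data.Fin.Properties using (all?; toℕ-fromℕ<)
open import Data.Product using (_×_; _,_)
open import Data.Sum using (_⊎_; [_,_]′)
open import Data.Unit using (tt)
open import Function using (_∘_)
open import Relation.Nullary using (yes; no; ¬?; contradiction)
open import Relation.Nullary.Decidable using (toWitness; _→-dec_)
open import Relation.Binary.PropositionalEquality
open ≡-Reasoning
open import Algebra.Properties.CommutativeSemigroup *-commutativeSemigroup using (interchange)

m%n≢0⇒NonZero : ∀ m n .{{_ : NonZero n}} → m % n ≢ 0 → NonZero m
m%n≢0⇒NonZero m (suc _) m%n≢0 = ≢-nonZero λ { refl → m%n≢0 refl }

m*10^[1+k]≡m*10^k*10 : ∀ m k → m * 10 ^ suc k ≡ m * 10 ^ k * 10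
m*10^[1+k]≡m*10^k*10 m k = begin
  m * (10 * 10 ^ k) ≡⟨ cong (m *_) (*-comm 10 (10 ^ k)) ⟩
  m * (10 ^ k * 10) ≡⟨ *-assoc m (10 ^ k) 10 ⟨
  m * 10 ^ k * 10   ∎

[m*n]^o≡m^o*n^o : ∀ m n o → (m * n) ^ o ≡ m ^ o * n ^ o
[m*n]^o≡m^o*n^o m n zero    = refl
[m*n]^o≡m^o*n^o m n (suc o) = begin
  m * n * (m * n) ^ o     ≡⟨ cong (m * n *_) ([m*n]^o≡m^o*n^o m n o) ⟩
  m * n * (m ^ o * n ^ o) ≡⟨ interchange m n (m ^ o) (n ^ o) ⟩
  m * m ^ o * (n * n ^ o) ∎

[1+m]/10≤m : ∀ m → suc m / 10 ≤ m
[1+m]/10≤m m = <⇒≤pred (m/n<m (suc m) 10 (s≤s (s≤s z≤n)))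

digitsAux-zero : ∀ fuel → digitsAux fuel 0 ≡ []
digitsAux-zero zero       = refl
digitsAux-zero (suc fuel) = refl

digitsAux-fuel : ∀ f g m → m ≤ f → m ≤ g → digitsAux f m ≡ digitsAux g m
digitsAux-fuel f g zero _ _ = trans (digitsAux-zero f) (sym (digitsAux-zero g))
digitsAux-fuel (suc f) (suc g) (suc m) (s≤s m≤f) (s≤s m≤g) =
  cong (suc m % 10 ∷_) (digitsAux-fuel f g (suc m / 10) (≤-trans q≤m m≤f) (≤-trans q≤m m≤g))
  where
  q≤m : suc m / 10 ≤ m
  q≤m = [1+m]/10≤m m

digits-nonZero : ∀ m .{{_ : NonZero m}} → digits m ≡ m % 10 ∷ digits (m / 10)
digits-nonZero (suc m) =
  cong (suc m % 10 ∷_) (digitsAux-fuel m (suc m / 10) (suc m / 10) ([1+m]/10≤m m) ≤-refl)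

digits-*10 : ∀ m .{{_ : NonZero m}} → digits (m * 10) ≡ 0 ∷ digits m
digits-*10 m = begin
  digits (m * 10)                    ≡⟨ digits-nonZero (m * 10) ⦃ m*n≢0 m 10 ⦄ ⟩
  m * 10 % 10 ∷ digits (m * 10 / 10) ≡⟨ cong₂ (λ u v → u ∷ digits v) (m*n%n≡0 m 10) (m*n/n≡m m 10) ⟩
  0 ∷ digits m                       ∎

lnzd-*10 : ∀ m .{{_ : NonZero m}} → lnzd (m * 10) ≡ lnzd m
lnzd-*10 m ⦃ m≢0 ⦄ rewrite digits-*10 m ⦃ m≢0 ⦄ = refl

rbln-*10 : ∀ m .{{_ : NonZero m}} → rbln (m * 10) ≡ rbln m
rbln-*10 m ⦃ m≢0 ⦄ rewrite digits-*10 m ⦃ m≢0 ⦄ = refl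

*10^-invariant : (f : ℕ → ℕ) → (∀ m .{{_ : NonZero m}} → f (m * 10) ≡ f m) →
                 ∀ m k .{{_ : NonZero m}} → f (m * 10 ^ k) ≡ f m
*10^-invariant f f-*10 m zero    = cong f (*-identityʳ m)
*10^-invariant f f-*10 m (suc k) ⦃ m≢0 ⦄ = begin
  f (m * 10 ^ suc k)    ≡⟨ cong f (m*10^[1+k]≡m*10^k*10 m k) ⟩
  f (m * 10 ^ k * 10)   ≡⟨ f-*10 (m * 10 ^ k) ⦃ m*n≢0 m (10 ^ k) ⦃ m≢0 ⦄ ⦃ m^n≢0 10 k ⦄ ⦄ ⟩
  f (m * 10 ^ k)        ≡⟨ *10^-invariant f f-*10 m k ⟩
  f m                   ∎

lnzd-∷ : ∀ {m u q} → u ≢ 0 → digits m ≡ u ∷ digits q → lnzd m ≡ u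
lnzd-∷ {u = zero}  u≢0 _  = contradiction refl u≢0
lnzd-∷ {u = suc _} _   eq rewrite eq = refl

rbln-∷ : ∀ {m u q} → u ≢ 0 → digits m ≡ u ∷ digits q → rbln m ≡ q % 10
rbln-∷ {u = zero}                 u≢0 _  = contradiction refl u≢0
rbln-∷ {u = suc _} {q = zero}     _   eq rewrite eq = refl
rbln-∷ {u = suc _} {q = q@(suc _)} _  eq rewrite eq with q % 10
-- a zero tens digit yields 0 whether or not m has a single non-zero digit
... | zero  = if-eta _
... | suc _ = refl

lnzd-unitDigit : ∀ m → m % 10 ≢ 0 → lnzd m ≡ m % 10
lnzd-unitDigit m m%10≢0 =
  lnzd-∷ m%10≢0 (digits-nonZero m ⦃ m%n≢0⇒NonZero m 10 m%10≢0 ⦄)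

rbln-unitDigit : ∀ m → m % 10 ≢ 0 → rbln m ≡ m / 10 % 10
rbln-unitDigit m m%10≢0 =
  rbln-∷ m%10≢0 (digits-nonZero m ⦃ m%n≢0⇒NonZero m 10 m%10≢0 ⦄)

record DecimalNormalForm (n : ℕ) : Set where
  field
    mantissa      : ℕ
    exponent      : ℕ
    mantissa%10≢0 : mantissa % 10 ≢ 0
    n≡mantissa*10^exponent : n ≡ mantissa * 10 ^ exponent

decimalNormalForm : ∀ n .{{_ : NonZero n}} → DecimalNormalForm n
decimalNormalForm n ⦃ n≢0 ⦄ = <-rec P normalise n n≢0
  where
  P : ℕ → Set
  P n = .(NonZero n) → DecimalNormalForm n

  shift : ∀ {n} → n ≡ n / 10 * 10 → DecimalNormalForm (n / 10) → DecimalNormalForm n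
  shift {n} n≡n/10*10 nf = record
    { mantissa      = mantissa
    ; exponent      = suc exponent
    ; mantissa%10≢0 = mantissa%10≢0
    ; n≡mantissa*10^exponent = begin
        n                             ≡⟨ n≡n/10*10 ⟩
        n / 10 * 10                   ≡⟨ cong (_* 10) n≡mantissa*10^exponent ⟩
        mantissa * 10 ^ exponent * 10 ≡⟨ m*10^[1+k]≡m*10^k*10 mantissa exponent ⟨
        mantissa * 10 ^ suc exponent  ∎
    }
    where open DecimalNormalForm nf

  normalise : ∀ n → (∀ {m} → m < n → P m) → P n
  normalise n rec n≢0 with n % 10 ≟ 0
  ... | no n%10≢0 = record
    { mantissa = n ; exponent = 0 ; mantissa%10≢0 = n%10≢0
    ; n≡mantissa*10^exponent = sym (*-identityʳ n) }
  ... | yes n%10≡0 = shift (sym (m/n*n≡m 10∣n)) (rec (m/n<m n 10 ⦃ n≢0 ⦄ (s≤s (s≤s z≤n))) n/10≢0)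
    where
    10∣n : 10 ∣ n
    10∣n = m%n≡0⇒n∣m n 10 n%10≡0
    n/10≢0 : NonZero (n / 10)
    n/10≢0 = >-nonZero (m≥n⇒m/n>0 (∣⇒≤ ⦃ n≢0 ⦄ 10∣n))

m^o%n≡[m%n]^o%n : ∀ m o n .{{_ : NonZero n}} → m ^ o % n ≡ (m % n) ^ o % n
m^o%n≡[m%n]^o%n m zero    n = refl
m^o%n≡[m%n]^o%n m (suc o) n = begin
  m * m ^ o % n                       ≡⟨ %-distribˡ-* m (m ^ o) n ⟩
  m % n * (m ^ o % n) % n             ≡⟨ cong₂ (λ u v → u * v % n) (m%n%n≡m%n m n) (sym (m^o%n≡[m%n]^o%n m o n)) ⟨
  m % n % n * ((m % n) ^ o % n) % n   ≡⟨ %-distribˡ-* (m % n) ((m % n) ^ o) n ⟨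
  m % n * (m % n) ^ o % n             ∎

idempotent⇒^-idempotent : ∀ e n .{{_ : NonZero n}} → e * e % n ≡ e % n →
                          ∀ o .{{_ : NonZero o}} → e ^ o % n ≡ e % n
idempotent⇒^-idempotent e n idem (suc zero)      = cong (_% n) (*-identityʳ e)
idempotent⇒^-idempotent e n idem (suc o@(suc _)) = begin
  e * e ^ o % n               ≡⟨ %-distribˡ-* e (e ^ o) n ⟩
  e % n * (e ^ o % n) % n     ≡⟨ cong (λ v → e % n * v % n) (idempotent⇒^-idempotent e n idem o) ⟩
  e % n * (e % n) % n         ≡⟨ %-distribˡ-* e e n ⟨
  e * e % n                   ≡⟨ idem ⟩
  e % n                       ∎

m%100%10≡m%10 : ∀ m → m % 100 % 10 ≡ m % 10
m%100%10≡m%10 m = m∣n⇒o%n%m≡o%m 10 100 m (divides 10 refl)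

-- m ^ 20 % 100 as a function of d = m % 10, for d ≢ 0 (the value at d = 0 is junk)
pow20Mod100 : ℕ → ℕ
pow20Mod100 d = if d ≡ᵇ 5 then 25 else if d % 2 ≡ᵇ 0 then 76 else 1

pow20Mod100-idempotent : ∀ d → pow20Mod100 d * pow20Mod100 d % 100 ≡ pow20Mod100 d % 100
pow20Mod100-idempotent d with d ≡ᵇ 5 | d % 2 ≡ᵇ 0
... | true  | _     = refl
... | false | true  = refl
... | false | false = refl

pow20Mod100-<100 : ∀ d → pow20Mod100 d % 100 ≡ pow20Mod100 d
pow20Mod100-<100 d with d ≡ᵇ 5 | d % 2 ≡ᵇ 0
... | true  | _     = refl
... | false | true  = refl
... | false | false = refl

pow20Mod100-unitDigit≢0 : ∀ d → pow20Mod100 d % 10 ≢ 0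
pow20Mod100-unitDigit≢0 d with d ≡ᵇ 5 | d % 2 ≡ᵇ 0
... | true  | _     = λ ()
... | false | true  = λ ()
... | false | false = λ ()

m^20%100-table : ∀ (r : Fin 100) → toℕ r % 10 ≢ 0 →
                 toℕ r ^ 20 % 100 ≡ pow20Mod100 (toℕ r % 10)
m^20%100-table = toWitness {a? = all? λ r →
  ¬? (toℕ r % 10 ≟ 0) →-dec (toℕ r ^ 20 % 100 ≟ pow20Mod100 (toℕ r % 10))} tt

m^20%100≡pow20Mod100 : ∀ m → m % 10 ≢ 0 → m ^ 20 % 100 ≡ pow20Mod100 (m % 10)
m^20%100≡pow20Mod100 m m%10≢0 = begin
  m ^ 20 % 100                ≡⟨ m^o%n≡[m%n]^o%n m 20 100 ⟩
  r ^ 20 % 100                ≡⟨ table (m%n<n m 100) r%10≢0 ⟩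
  pow20Mod100 (r % 10)        ≡⟨ cong pow20Mod100 r%10≡m%10 ⟩
  pow20Mod100 (m % 10)        ∎
  where
  r = m % 100
  r%10≡m%10 : r % 10 ≡ m % 10
  r%10≡m%10 = m%100%10≡m%10 m
  r%10≢0 : r % 10 ≢ 0
  r%10≢0 = m%10≢0 ∘ trans (sym r%10≡m%10)
  table : ∀ {r} → r < 100 → r % 10 ≢ 0 → r ^ 20 % 100 ≡ pow20Mod100 (r % 10)
  table r<100 = subst (λ x → x % 10 ≢ 0 → x ^ 20 % 100 ≡ pow20Mod100 (x % 10))
                      (toℕ-fromℕ< r<100) (m^20%100-table (fromℕ< r<100))

20∣n⇒m^n%100≡pow20Mod100 : ∀ m n .{{_ : NonZero n}} → 20 ∣ n → m % 10 ≢ 0 →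
                            m ^ n % 100 ≡ pow20Mod100 (m % 10)
20∣n⇒m^n%100≡pow20Mod100 m n 20∣n m%10≢0 = begin
  m ^ n % 100                 ≡⟨ cong (λ k → m ^ k % 100) (m*[n/m]≡n 20∣n) ⟨
  m ^ (20 * t) % 100          ≡⟨ cong (_% 100) (^-*-assoc m 20 t) ⟨
  (m ^ 20) ^ t % 100          ≡⟨ m^o%n≡[m%n]^o%n (m ^ 20) t 100 ⟩
  (m ^ 20 % 100) ^ t % 100    ≡⟨ cong (λ x → x ^ t % 100) (m^20%100≡pow20Mod100 m m%10≢0) ⟩
  e ^ t % 100                 ≡⟨ idempotent⇒^-idempotent e 100 (pow20Mod100-idempotent (m % 10)) t ⦃ t≢0 ⦄ ⟩
  e % 100                     ≡⟨ pow20Mod100-<100 (m % 10) ⟩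
  e                           ∎
  where
  t = n / 20
  t≢0 : NonZero t
  t≢0 = >-nonZero (m≥n⇒m/n>0 (∣⇒≤ 20∣n))
  e = pow20Mod100 (m % 10)

rbln-selfPower : ∀ n .{{_ : NonZero n}} → 100 ∣ n → rbln (n ^ n) ≡ pow20Mod100 (lnzd n) / 10
rbln-selfPower n 100∣n = begin
  rbln (n ^ n)                    ≡⟨ cong rbln n^n≡m^n*10^[k*n] ⟩
  rbln (m ^ n * 10 ^ (k * n))     ≡⟨ *10^-invariant rbln rbln-*10 (m ^ n) (k * n) ⦃ m^n≢0 m n ⦃ m≢0 ⦄ ⦄ ⟩
  rbln (m ^ n)                    ≡⟨ rbln-unitDigit (m ^ n) m^n%10≢0 ⟩
  m ^ n / 10 % 10                 ≡⟨ m%[n*o]/o≡m/o%n (m ^ n) 10 10 ⟨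
  m ^ n % 100 / 10                ≡⟨ cong (_/ 10) m^n%100 ⟩
  pow20Mod100 (m % 10) / 10       ≡⟨ cong (λ d → pow20Mod100 d / 10) lnzd-n ⟨
  pow20Mod100 (lnzd n) / 10       ∎
  where
  open DecimalNormalForm (decimalNormalForm n) renaming (mantissa to m; exponent to k)
  m≢0 : NonZero m
  m≢0 = m%n≢0⇒NonZero m 10 mantissa%10≢0
  lnzd-n : lnzd n ≡ m % 10
  lnzd-n = begin
    lnzd n              ≡⟨ cong lnzd n≡mantissa*10^exponent ⟩
    lnzd (m * 10 ^ k)   ≡⟨ *10^-invariant lnzd lnzd-*10 m k ⦃ m≢0 ⦄ ⟩
    lnzd m              ≡⟨ lnzd-unitDigit m mantissa%10≢0 ⟩
    m % 10              ∎
  n^n≡m^n*10^[k*n] : n ^ n ≡ m ^ n * 10 ^ (k * n)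
  n^n≡m^n*10^[k*n] = begin
    n ^ n                 ≡⟨ cong (_^ n) n≡mantissa*10^exponent ⟩
    (m * 10 ^ k) ^ n      ≡⟨ [m*n]^o≡m^o*n^o m (10 ^ k) n ⟩
    m ^ n * (10 ^ k) ^ n  ≡⟨ cong (m ^ n *_) (^-*-assoc 10 k n) ⟩
    m ^ n * 10 ^ (k * n)  ∎
  m^n%100 : m ^ n % 100 ≡ pow20Mod100 (m % 10)
  m^n%100 = 20∣n⇒m^n%100≡pow20Mod100 m n (∣-trans (divides 5 refl) 100∣n) mantissa%10≢0
  m^n%10≢0 : m ^ n % 10 ≢ 0
  m^n%10≢0 = pow20Mod100-unitDigit≢0 (m % 10)
           ∘ subst (λ x → x % 10 ≡ 0) m^n%100
           ∘ trans (m%100%10≡m%10 (m ^ n))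

corollary2p3 : (n : ℕ) → n > 0 → 100 ∣ n →
    ((lnzd n ≡ 2 ⊎ lnzd n ≡ 4 ⊎ lnzd n ≡ 6 ⊎ lnzd n ≡ 8) → rbln (n ^ n) ≡ 7)
    × (lnzd n ≡ 5 → rbln (n ^ n) ≡ 2)
    × ((lnzd n ≡ 1 ⊎ lnzd n ≡ 3 ⊎ lnzd n ≡ 7 ⊎ lnzd n ≡ 9) → rbln (n ^ n) ≡ 0)
corollary2p3 n n>0 100∣n =
  [ rbln-at , [ rbln-at , [ rbln-at , rbln-at ]′ ]′ ]′ ,
  rbln-at ,
  [ rbln-at , [ rbln-at , [ rbln-at , rbln-at ]′ ]′ ]′
  where
  rbln-at : ∀ {d} → lnzd n ≡ d → rbln (n ^ n) ≡ pow20Mod100 d / 10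
  rbln-at lnzd≡d =
    trans (rbln-selfPower n ⦃ >-nonZero n>0 ⦄ 100∣n) (cong (λ d → pow20Mod100 d / 10) lnzd≡d)
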